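{- Let $1<d_1<d_2<d_3$ be integers with $\gcd(d_1,d_2)=1$ such that $\{d_1,d_2,d_3\}$ is a minimal generating set of the semigroup $S(d_1,d_2,d_3)$, let $\Delta=\Delta(d_1,d_2,d_3)$ and $\Phi(z)=\sum_{s\in\Delta}z^s$. For $1\le q\le d_1-1$ let $p_t(q)=\min\{p\ge1:\ d_1d_2-pd_1-qd_2\in\Delta\}$ and $\lambda_q=d_1d_2-(p_t(q)-1)d_1-qd_2$. Then $$(1-z^{d_1})\Phi(z)=\sum_{q=1}^{d_1-1}z^q-\sum_{q=1}^{d_1-1}z^{\lambda_q}.$$
   Context: $S(d_1,d_2,d_3)$ is the set of nonnegative integer combinations of $d_1,d_2,d_3$; minimal means no $d_i$ is a nonnegative integer combination of the other two. $\Delta(d_1,d_2,d_3)$ is the set of positive integers not in $S(d_1,d_2,d_3)$. (For each $q$ the set over which the minimum defining $p_t(q)$ is taken is nonempty.) -}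

module Defs where

open import Data.Nat as ℕ using (ℕ; zero; suc; _+_; _*_; _∸_; _≤_; _<_; z≤n; s≤s)
open import Data.Nat.Properties as ℕP using (≤-trans; ≤-refl; m≤m+n; m≤n+m; *-zeroʳ; m≤m*n; ≤-pred)
open import Data.Integer as ℤ using (ℤ; +_; -[1+_]; _-_)
import Data.Integer.Properties as ℤP
open import Data.List using (List; map; upTo; filter; length)
open import Data.Sum using (inj₁; inj₂)
open import Data.Product using (Σ; ∃; _×_; _,_; proj₁; proj₂)
open import Relation.Nullary using (¬_; Dec; yes; no)
open import Relation.Nullary.Decidable using (map′)
open import Relation.Binary.PropositionalEquality using (_≡_; refl; sym; trans; cong; cong₂; subst)

InS : ℕ → ℕ → ℕ → ℕ → Set
InS d₁ d₂ d₃ n = ∃ λ a → ∃ λ b → ∃ λ c → a * d₁ + b * d₂ + c * d₃ ≡ n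

InΔ : ℕ → ℕ → ℕ → ℤ → Set
InΔ d₁ d₂ d₃ x = ∃ λ m → x ≡ + suc m × ¬ InS d₁ d₂ d₃ (suc m)

Minimal : ℕ → ℕ → ℕ → Set
Minimal d₁ d₂ d₃ =
  (¬ ∃ λ b → ∃ λ c → b * d₂ + c * d₃ ≡ d₁) ×
  (¬ ∃ λ a → ∃ λ c → a * d₁ + c * d₃ ≡ d₂) ×
  (¬ ∃ λ a → ∃ λ b → a * d₁ + b * d₂ ≡ d₃)

private
  bsearch : (P : ℕ → Set) → (∀ k → Dec (P k)) → ∀ n → Dec (∃ λ k → k ≤ n × P k)
  bsearch P P? zero with P? zero
  ... | yes p = yes (zero , z≤n , p)
  ... | no ¬p = no λ { (zero , _ , p) → ¬p p ; (suc k , () , _) }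
  bsearch P P? (suc n) with P? (suc n) | bsearch P P? n
  ... | yes p | _ = yes (suc n , ≤-refl , p)
  ... | no _ | yes (k , k≤n , p) = yes (k , ≤-trans k≤n (ℕP.n≤1+n n) , p)
  ... | no ¬p | no ¬r = no f
    where
    f : ¬ ∃ λ k → k ≤ suc n × P k
    f (k , k≤ , p) with ℕP.m≤n⇒m<n∨m≡n k≤
    ... | inj₁ k< = ¬r (k , ≤-pred k< , p)
    ... | inj₂ refl = ¬p p

  norm : ∀ d a → ∃ λ a' → a' ≤ a * d × a' * d ≡ a * d
  norm zero a = zero , z≤n , sym (*-zeroʳ a)
  norm (suc e) a = a , m≤m*n a (suc e) , refl

  BS : ℕ → ℕ → ℕ → ℕ → Set
  BS d₁ d₂ d₃ n = ∃ λ a → a ≤ n × ∃ λ b → b ≤ n × ∃ λ c → c ≤ n × a * d₁ + b * d₂ + c * d₃ ≡ n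

  BS? : ∀ d₁ d₂ d₃ n → Dec (BS d₁ d₂ d₃ n)
  BS? d₁ d₂ d₃ n =
    bsearch _ (λ a → bsearch _ (λ b → bsearch _ (λ c → a * d₁ + b * d₂ + c * d₃ ℕ.≟ n) n) n) n

  toS : ∀ {d₁ d₂ d₃ n} → BS d₁ d₂ d₃ n → InS d₁ d₂ d₃ n
  toS (a , _ , b , _ , c , _ , e) = a , b , c , e

  fromS : ∀ {d₁ d₂ d₃ n} → InS d₁ d₂ d₃ n → BS d₁ d₂ d₃ n
  fromS {d₁} {d₂} {d₃} {n} (a , b , c , e)
    with norm d₁ a | norm d₂ b | norm d₃ c
  ... | a' , a'≤ , ea | b' , b'≤ , eb | c' , c'≤ , ec =
    a' , ≤-trans a'≤ (≤-trans (≤-trans (m≤m+n (a * d₁) (b * d₂)) (m≤m+n _ (c * d₃))) (≤n)) ,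
    b' , ≤-trans b'≤ (≤-trans (≤-trans (m≤n+m (b * d₂) (a * d₁)) (m≤m+n _ (c * d₃))) (≤n)) ,
    c' , ≤-trans c'≤ (≤-trans (m≤n+m (c * d₃) (a * d₁ + b * d₂)) (≤n)) ,
    trans (cong₂ _+_ (cong₂ _+_ ea eb) ec) e
    where
    ≤n : a * d₁ + b * d₂ + c * d₃ ≤ n
    ≤n = subst (a * d₁ + b * d₂ + c * d₃ ≤_) e ≤-refl

InS? : ∀ d₁ d₂ d₃ n → Dec (InS d₁ d₂ d₃ n)
InS? d₁ d₂ d₃ n = map′ toS fromS (BS? d₁ d₂ d₃ n)

InΔ? : ∀ d₁ d₂ d₃ x → Dec (InΔ d₁ d₂ d₃ x)
InΔ? d₁ d₂ d₃ (+ zero) = no λ { (m , () , _) }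
InΔ? d₁ d₂ d₃ -[1+ k ] = no λ { (m , () , _) }
InΔ? d₁ d₂ d₃ (+ suc m) with InS? d₁ d₂ d₃ (suc m)
... | yes s = no λ { (m' , refl , ns) → ns s }
... | no ns = yes (m , refl , ns)

-- Φ(z) = Σ_{s∈Δ} z^s, represented by its coefficient function on ℤ
-- (coefficient of z^x is 1 if x ∈ Δ, 0 otherwise).

coeffΦ : ℕ → ℕ → ℕ → ℤ → ℤ
coeffΦ d₁ d₂ d₃ x with InΔ? d₁ d₂ d₃ x
... | yes _ = + 1
... | no _ = + 0

coeffLHS : ℕ → ℕ → ℕ → ℤ → ℤ
coeffLHS d₁ d₂ d₃ x = coeffΦ d₁ d₂ d₃ x - coeffΦ d₁ d₂ d₃ (x - + d₁)

val : ℕ → ℕ → ℕ → ℕ → ℤ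
val d₁ d₂ p q = + (d₁ * d₂) - + (p * d₁) - + (q * d₂)

IsPt : ℕ → ℕ → ℕ → ℕ → ℕ → Set
IsPt d₁ d₂ d₃ q p =
  1 ≤ p × InΔ d₁ d₂ d₃ (val d₁ d₂ p q) ×
  (∀ p' → 1 ≤ p' → p' < p → ¬ InΔ d₁ d₂ d₃ (val d₁ d₂ p' q))

-- λ_q = d₁d₂ - (p_t(q) - 1) d₁ - q d₂   (p_t(q) ≥ 1, so ∸ is exact)
lam : ℕ → ℕ → (ℕ → ℕ) → ℕ → ℤ
lam d₁ d₂ pt q = val d₁ d₂ (pt q ∸ 1) q

qs : ℕ → List ℕ
qs d₁ = map suc (upTo (d₁ ∸ 1))

-- Coefficient of z^x in Σ_{q=1}^{d₁-1} z^q - Σ_{q=1}^{d₁-1} z^{λ_q}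
coeffRHS : ℕ → ℕ → (ℕ → ℕ) → ℤ → ℤ
coeffRHS d₁ d₂ pt x =
  + length (filter (λ q → + q ℤ.≟ x) (qs d₁))
  - + length (filter (λ q → lam d₁ d₂ pt q ℤ.≟ x) (qs d₁))

-- The coefficient of z^x in (1 - z^{d₁})Φ(z) is [x ∈ Δ] - [x - d₁ ∈ Δ]. As d₁ ∈ S and no integer
-- in [1, d₁) lies in S, it is 1 exactly when 1 ≤ x < d₁ and -1 exactly when x is a nonzero
-- element of the Apéry set Ap(S, d₁) = {a ∈ S : a - d₁ ∉ S}. So it suffices that q ↦ λ_q is a
-- bijection from {1, …, d₁ - 1} onto Ap(S, d₁) ∖ {0}. Each λ_q lies in Ap(S, d₁) by the
-- minimality of p_t(q), and λ_q ≡ -q d₂ (mod d₁) with gcd(d₁, d₂) = 1, so the λ_q realise every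
-- nonzero residue mod d₁ exactly once; an Apéry element is determined by its residue mod d₁.
module Submission where

open import Defs
open import Data.Nat using (ℕ; _<_; _≤_; _∸_)
open import Data.Nat.GCD using (gcd)
open import Data.Integer using (ℤ)
open import Relation.Binary.PropositionalEquality using (_≡_)

open import Data.Nat using (zero; suc; _+_; _*_; z≤n; s≤s; _<?_)
open import Data.Nat.Properties
  using (≤-refl; ≤-trans; ≤-total; <-irrefl; <-trans; <⇒≤; <⇒≱; ≮⇒≥; m≤m+n; m≤n+m;
         +-identityʳ; +-assoc; +-comm; +-cancelˡ-≡; +-cancelʳ-≡; m+n∸n≡m; m∸n+n≡m;
         *-comm; *-assoc; *-identityˡ; *-distribʳ-∸; m≤n⇒∃[o]m+o≡n)
open import Data.Nat.Coprimality using (Coprime; gcd≡1⇒coprime; coprime-Bézout; coprime-divisor)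
open import Data.Nat.Divisibility using (_∣_; divides; ∣-refl; ∣m+n∣m⇒∣n; n∣m*n; n∣m*n*o; ∣n⇒∣m*n; ∣⇒≤)
open import Data.Nat.DivMod using (_%_; _/_; m≡m%n+[m/n]*n; m%n<n)
open import Data.Nat.GCD using (module Bézout)
open import Data.Nat.Tactic.RingSolver using (solve-∀)
open import Data.Integer as ℤ using (+_)
import Data.Integer.Properties as ℤ
import Data.Integer.Tactic.RingSolver as ℤ-Solver
open import Data.List using (filter; length)
open import Data.List.Relation.Unary.AllPairs using (_∷_)
open import Data.List.Properties using (filter-accept; filter-reject; filter-none)
open import Data.List.Membership.Propositional using (_∈_)
open import Data.List.Membership.Propositional.Properties using (∈-map⁺; ∈-map⁻; ∈-upTo⁺; ∈-upTo⁻)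
open import Data.List.Relation.Unary.Any using (here; there)
import Data.List.Relation.Unary.All as All
open import Data.List.Relation.Unary.Unique.Propositional using (Unique)
import Data.List.Relation.Unary.Unique.Propositional.Properties as Unique
open import Data.Product using (∃; _×_; _,_; proj₂)
open import Data.Sum using (inj₁; inj₂)
open import Function using (_∘_)
open import Level using (0ℓ)
open import Relation.Nullary using (¬_; yes; no; contradiction)
open import Relation.Nullary.Decidable using (decidable-stable)
open import Relation.Unary using (Pred; Decidable)
open import Relation.Binary.PropositionalEquality
  using (refl; sym; trans; cong; cong₂; subst; module ≡-Reasoning)

open ≡-Reasoning

length-filter-unique : ∀ {A : Set} {P : Pred A 0ℓ} (P? : Decidable P) {x xs} →
  Unique xs → x ∈ xs → P x → (∀ {y} → y ∈ xs → P y → y ≡ x) → length (filter P? xs) ≡ 1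
length-filter-unique P? (x∉xs ∷ _) (here refl) Px only =
  trans (cong length (filter-accept P? Px))
        (cong (suc ∘ length) (filter-none P? (All.tabulate λ y∈ Py →
          All.lookup x∉xs y∈ (sym (only (there y∈) Py)))))
length-filter-unique P? (y∉xs ∷ xs-unique) (there x∈) Px only =
  trans (cong length (filter-reject P? λ Py → All.lookup y∉xs x∈ (only (here refl) Py)))
        (length-filter-unique P? xs-unique x∈ Px (only ∘ there))

length-filter-none : ∀ {A : Set} {P : Pred A 0ℓ} (P? : Decidable P) xs →
  (∀ {y} → y ∈ xs → ¬ P y) → length (filter P? xs) ≡ 0
length-filter-none P? _ none = cong length (filter-none P? (All.tabulate none))

∈-qs⁺ : ∀ {d q} → 0 < q → q < d → q ∈ qs d
∈-qs⁺ {suc d} {suc q} _ (s≤s q<d) = ∈-map⁺ suc (∈-upTo⁺ q<d)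

∈-qs⁻ : ∀ {d q} → q ∈ qs d → 0 < q × q < d
∈-qs⁻ {suc d} q∈ with _ , i∈ , refl ← ∈-map⁻ suc q∈ = s≤s z≤n , s≤s (∈-upTo⁻ i∈)

qs-unique : ∀ d → Unique (qs d)
qs-unique d = Unique.map⁺ (λ { refl → refl }) (Unique.upTo⁺ (d ∸ 1))

m+n*o≡p*o⇒m≡[p∸n]*o : ∀ m n o p → m + n * o ≡ p * o → m ≡ (p ∸ n) * o
m+n*o≡p*o⇒m≡[p∸n]*o m n o p eq = begin
  m                  ≡⟨ sym (m+n∸n≡m m (n * o)) ⟩
  m + n * o ∸ n * o  ≡⟨ cong (_∸ n * o) eq ⟩
  p * o ∸ n * o      ≡⟨ sym (*-distribʳ-∸ o p n) ⟩
  (p ∸ n) * o        ∎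

∣∧<⇒≡0 : ∀ {d k} → d ∣ k → k < d → k ≡ 0
∣∧<⇒≡0 {k = zero} _ _ = refl
∣∧<⇒≡0 {k = suc k} d∣k k<d = contradiction (∣⇒≤ d∣k) (<⇒≱ k<d)

coprime⇒∃[y]∣y*e+1 : ∀ {d e} → Coprime (suc d) e → ∃ λ y → suc d ∣ y * e + 1
coprime⇒∃[y]∣y*e+1 {d} {e} d⊥e with coprime-Bézout d⊥e
... | Bézout.+- x y eq = y , divides x (trans (+-comm (y * e) 1) eq)
... | Bézout.-+ x y eq = d * y , divides (1 + d * x) (begin
  d * y * e + 1            ≡⟨ cong (_+ 1) (*-assoc d y e) ⟩
  d * (y * e) + 1          ≡⟨ cong (λ t → d * t + 1) (sym eq) ⟩
  d * (1 + x * suc d) + 1  ≡⟨ regroup d x ⟩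
  (1 + d * x) * suc d      ∎)
  where
  regroup : ∀ d x → d * (1 + x * suc d) + 1 ≡ (1 + d * x) * suc d
  regroup = solve-∀

∣m*o+n⇒∣[m%d]*o+n : ∀ {d} m n o → suc d ∣ m * o + n → suc d ∣ m % suc d * o + n
∣m*o+n⇒∣[m%d]*o+n {d} m n o d∣ = ∣m+n∣m⇒∣n (subst (suc d ∣_) split d∣) (n∣m*n*o (m / suc d) o)
  where
  regroup : ∀ r s o n → (r + s) * o + n ≡ s * o + (r * o + n)
  regroup = solve-∀
  split : m * o + n ≡ m / suc d * suc d * o + (m % suc d * o + n)
  split = begin
    m * o + n                                 ≡⟨ cong (λ t → t * o + n) (m≡m%n+[m/n]*n m (suc d)) ⟩
    (m % suc d + m / suc d * suc d) * o + n   ≡⟨ regroup (m % suc d) (m / suc d * suc d) o n ⟩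
    m / suc d * suc d * o + (m % suc d * o + n) ∎

coprime⇒residue : ∀ {d e} → 0 < d → Coprime d e → ∀ n → ∃ λ q → q < d × d ∣ q * e + n
coprime⇒residue {suc d} {e} _ d⊥e n with y , d∣ ← coprime⇒∃[y]∣y*e+1 d⊥e =
  n * y % suc d , m%n<n (n * y) (suc d) ,
  ∣m*o+n⇒∣[m%d]*o+n (n * y) n e (subst (suc d ∣_) (distrib n y e) (∣n⇒∣m*n n d∣))
  where
  distrib : ∀ n y e → n * (y * e + 1) ≡ n * y * e + n
  distrib = solve-∀

module _ {d e : ℕ} (d⊥e : Coprime d e) where

  coprime-cancel-≤ : ∀ {P P' q q'} → q ≤ q' → q' < d → P * d + q * e ≡ P' * d + q' * e → q ≡ q'
  coprime-cancel-≤ {P} {P'} {q} q≤q' q'<d eq with k , refl ← m≤n⇒∃[o]m+o≡n q≤q' =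
    sym (trans (cong (λ t → q + t) k≡0) (+-identityʳ q))
    where
    eq' : P * d + q * e ≡ (P' * d + k * e) + q * e
    eq' = trans eq (regroup P' d q k e)
      where
      regroup : ∀ P' d q k e → P' * d + (q + k) * e ≡ (P' * d + k * e) + q * e
      regroup = solve-∀
    d∣k*e : d ∣ k * e
    d∣k*e = ∣m+n∣m⇒∣n (subst (d ∣_) (+-cancelʳ-≡ (q * e) _ _ eq') (n∣m*n P)) (n∣m*n P')
    k≡0 : k ≡ 0
    k≡0 = ∣∧<⇒≡0 (coprime-divisor d⊥e (subst (d ∣_) (*-comm k e) d∣k*e)) (≤-trans (s≤s (m≤n+m k q)) q'<d)

  coprime-cancel : ∀ {P P' q q'} → q < d → q' < d → P * d + q * e ≡ P' * d + q' * e → q ≡ q'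
  coprime-cancel {P} {P'} {q} {q'} q<d q'<d eq with ≤-total q q'
  ... | inj₁ q≤q' = coprime-cancel-≤ {P} {P'} q≤q' q'<d eq
  ... | inj₂ q'≤q = sym (coprime-cancel-≤ {P'} {P} q'≤q q<d (sym eq))

module _ (d₁ d₂ : ℕ) where

  val-suc : ∀ p q → val d₁ d₂ (suc p) q ℤ.+ + d₁ ≡ val d₁ d₂ p q
  val-suc p q = cancel (+ (d₁ * d₂)) (+ d₁) (+ (p * d₁)) (+ (q * d₂))
    where
    cancel : ∀ a d b c → a ℤ.- (d ℤ.+ b) ℤ.- c ℤ.+ d ≡ a ℤ.- b ℤ.- c
    cancel = ℤ-Solver.solve-∀

  val≡+⇒ : ∀ p q {L} → val d₁ d₂ p q ≡ + L → L + p * d₁ + q * d₂ ≡ d₁ * d₂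
  val≡+⇒ p q {L} eq = ℤ.+-injective (begin
    + L ℤ.+ + (p * d₁) ℤ.+ + (q * d₂)               ≡⟨ cong (λ t → t ℤ.+ + (p * d₁) ℤ.+ + (q * d₂)) (sym eq) ⟩
    val d₁ d₂ p q ℤ.+ + (p * d₁) ℤ.+ + (q * d₂)      ≡⟨ cancel (+ (d₁ * d₂)) (+ (p * d₁)) (+ (q * d₂)) ⟩
    + (d₁ * d₂)                                      ∎)
    where
    cancel : ∀ a b c → a ℤ.- b ℤ.- c ℤ.+ b ℤ.+ c ≡ a
    cancel = ℤ-Solver.solve-∀

module Gaps (d₁ d₂ d₃ : ℕ) where

  S : ℕ → Set
  S = InS d₁ d₂ d₃

  Δ : ℤ → Set
  Δ = InΔ d₁ d₂ d₃

  S-+ : ∀ {m n} → S m → S n → S (m + n)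
  S-+ (a , b , c , refl) (a' , b' , c' , refl) = a + a' , b + b' , c + c' , regroup a a' b b' c c' d₁ d₂ d₃
    where
    regroup : ∀ a a' b b' c c' x y z →
      (a + a') * x + (b + b') * y + (c + c') * z ≡ (a * x + b * y + c * z) + (a' * x + b' * y + c' * z)
    regroup = solve-∀

  S-*d₁ : ∀ k → S (k * d₁)
  S-*d₁ k = k , 0 , 0 , trans (+-identityʳ _) (+-identityʳ _)

  S-*d₂ : ∀ k → S (k * d₂)
  S-*d₂ k = 0 , k , 0 , +-identityʳ _

  ¬S⇒Δ : ∀ {n} → ¬ S n → Δ (+ n)
  ¬S⇒Δ {zero} ¬S0 = contradiction (S-*d₁ 0) ¬S0
  ¬S⇒Δ {suc n} ¬Sn = n , refl , ¬Sn

  Δ⇒¬S : ∀ {n} → Δ (+ n) → ¬ S n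
  Δ⇒¬S (_ , refl , ¬Sn) = ¬Sn

  ¬Δ⇒S : ∀ {n} → ¬ Δ (+ n) → S n
  ¬Δ⇒S ¬Δn = decidable-stable (InS? d₁ d₂ d₃ _) (¬Δn ∘ ¬S⇒Δ)

  Δ[x-d₁]⇒ : ∀ {x} → Δ (x ℤ.- + d₁) → ∃ λ w → x ≡ + (w + d₁) × ¬ S w
  Δ[x-d₁]⇒ {x} (m , x-d₁≡ , ¬S) = suc m , trans (shift x (+ d₁)) (cong (ℤ._+ + d₁) x-d₁≡) , ¬S
    where
    shift : ∀ x d → x ≡ x ℤ.- d ℤ.+ d
    shift = ℤ-Solver.solve-∀

  S-+d₁ : ∀ {n} → S n → S (n + d₁)
  S-+d₁ Sn = S-+ Sn (subst S (*-identityˡ d₁) (S-*d₁ 1))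

  ¬Δ[n-d₁]⇒S : ∀ {n} → d₁ ≤ n → ¬ Δ (+ n ℤ.- + d₁) → S n
  ¬Δ[n-d₁]⇒S {n} d₁≤n ¬Δ[n-d₁] =
    subst S (m∸n+n≡m d₁≤n) (S-+d₁ (¬Δ⇒S (¬Δ[n-d₁] ∘ subst Δ (sym n-d₁≡))))
    where
    n-d₁≡ : + n ℤ.- + d₁ ≡ + (n ∸ d₁)
    n-d₁≡ = trans (ℤ.m-n≡m⊖n n d₁) (ℤ.⊖-≥ d₁≤n)

  gap-below : d₁ ≤ d₂ → d₁ ≤ d₃ → ∀ {n} → 0 < n → n < d₁ → ¬ S n
  gap-below _ _ 0<n _ (0 , 0 , 0 , refl) = <-irrefl refl 0<n
  gap-below _ _ _ n<d₁ (suc a , b , c , refl) =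
    <⇒≱ n<d₁ (≤-trans (m≤m+n d₁ (a * d₁)) (≤-trans (m≤m+n _ (b * d₂)) (m≤m+n _ (c * d₃))))
  gap-below d₁≤d₂ _ _ n<d₁ (a , suc b , c , refl) =
    <⇒≱ n<d₁ (≤-trans d₁≤d₂
      (≤-trans (m≤m+n d₂ (b * d₂)) (≤-trans (m≤n+m _ (a * d₁)) (m≤m+n _ (c * d₃)))))
  gap-below _ d₁≤d₃ _ n<d₁ (a , b , suc c , refl) =
    <⇒≱ n<d₁ (≤-trans d₁≤d₃ (≤-trans (m≤m+n d₃ (c * d₃)) (m≤n+m _ (a * d₁ + b * d₂))))

  -- w is an ApéryGap iff w + d₁ is a nonzero element of the Apéry set {a ∈ S : a - d₁ ∉ S}.
  ApéryGap : ℕ → Set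
  ApéryGap w = ¬ S w × S (w + d₁)

  apéry-unique-≤ : ∀ {w w' A B} → ¬ S w → S (w' + d₁) → A ≤ B → w + A * d₁ ≡ w' + B * d₁ → w ≡ w'
  apéry-unique-≤ {w} {w'} {A} ¬Sw Sw'+d₁ A≤B eq with k , refl ← m≤n⇒∃[o]m+o≡n A≤B =
    w≡w'+k*d₁⇒w≡w' k (+-cancelʳ-≡ (A * d₁) _ _ (trans eq (regroup w' A k d₁)))
    where
    regroup : ∀ w' A k d → w' + (A + k) * d ≡ (w' + k * d) + A * d
    regroup = solve-∀
    w≡w'+k*d₁⇒w≡w' : ∀ k → w ≡ w' + k * d₁ → w ≡ w'
    w≡w'+k*d₁⇒w≡w' zero w≡ = trans w≡ (+-identityʳ w')
    w≡w'+k*d₁⇒w≡w' (suc k) w≡ =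
      contradiction (subst S (sym (trans w≡ (sym (+-assoc w' d₁ (k * d₁))))) (S-+ Sw'+d₁ (S-*d₁ k))) ¬Sw

  apéry-unique : ∀ {w w' A B} → ApéryGap w → ApéryGap w' → w + A * d₁ ≡ w' + B * d₁ → w ≡ w'
  apéry-unique {A = A} {B} (¬Sw , Sw+d₁) (¬Sw' , Sw'+d₁) eq with ≤-total A B
  ... | inj₁ A≤B = apéry-unique-≤ ¬Sw Sw'+d₁ A≤B eq
  ... | inj₂ B≤A = sym (apéry-unique-≤ ¬Sw' Sw+d₁ B≤A (sym eq))

  IsPt⇒S : ∀ q p {L} → IsPt d₁ d₂ d₃ q (suc p) → val d₁ d₂ p q ≡ + L → S L
  IsPt⇒S q zero {L} _ val≡ = subst S (sym (m+n*o≡p*o⇒m≡[p∸n]*o L q d₂ d₁ L+q*d₂≡d₁*d₂)) (S-*d₂ (d₁ ∸ q))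
    where
    L+q*d₂≡d₁*d₂ : L + q * d₂ ≡ d₁ * d₂
    L+q*d₂≡d₁*d₂ = trans (cong (_+ q * d₂) (sym (+-identityʳ L))) (val≡+⇒ d₁ d₂ 0 q val≡)
  IsPt⇒S q (suc p) (_ , _ , below) val≡ =
    ¬Δ⇒S λ ΔL → below (suc p) (s≤s z≤n) ≤-refl (subst Δ (sym val≡) ΔL)

  IsPt⇒ApéryGap : ∀ q p → IsPt d₁ d₂ d₃ q p → ∃ λ w → val d₁ d₂ (p ∸ 1) q ≡ + (w + d₁) × ApéryGap w
  IsPt⇒ApéryGap q (suc p) isPt@(_ , (m , val≡ , ¬Sw) , _) = suc m , shift , ¬Sw , IsPt⇒S q p isPt shift
    where
    shift : val d₁ d₂ p q ≡ + (suc m + d₁)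
    shift = trans (sym (val-suc d₁ d₂ p q)) (cong (ℤ._+ + d₁) val≡)

module Coefficients (d₁ d₂ d₃ : ℕ) (1<d₁ : 1 < d₁) (d₁<d₂ : d₁ < d₂) (d₂<d₃ : d₂ < d₃)
  (d₁⊥d₂ : Coprime d₁ d₂) (pt : ℕ → ℕ) (pt-spec : ∀ q → 1 ≤ q → q ≤ d₁ ∸ 1 → IsPt d₁ d₂ d₃ q (pt q)) where

  open Gaps d₁ d₂ d₃

  low≟ : ∀ x → Decidable (λ q → + q ≡ x)
  low≟ x q = + q ℤ.≟ x

  lam≟ : ∀ x → Decidable (λ q → lam d₁ d₂ pt q ≡ x)
  lam≟ x q = lam d₁ d₂ pt q ℤ.≟ x

  #low : ℤ → ℕ
  #low x = length (filter (low≟ x) (qs d₁))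

  #lam : ℤ → ℕ
  #lam x = length (filter (lam≟ x) (qs d₁))

  lam-ApéryGap : ∀ {q} → q ∈ qs d₁ → ∃ λ w → lam d₁ d₂ pt q ≡ + (w + d₁) × ApéryGap w
  lam-ApéryGap q∈ with i , i∈ , refl ← ∈-map⁻ suc q∈ =
    IsPt⇒ApéryGap (suc i) (pt (suc i)) (pt-spec (suc i) (s≤s z≤n) (∈-upTo⁻ i∈))

  low-Δ : ∀ {q} → q ∈ qs d₁ → Δ (+ q)
  low-Δ q∈ with 0<q , q<d₁ ← ∈-qs⁻ q∈ =
    ¬S⇒Δ (gap-below (<⇒≤ d₁<d₂) (<⇒≤ (<-trans d₁<d₂ d₂<d₃)) 0<q q<d₁)

  low-¬Δ[-d₁] : ∀ {q} → q ∈ qs d₁ → ¬ Δ (+ q ℤ.- + d₁)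
  low-¬Δ[-d₁] q∈ Δ[q-d₁] with w , q≡ , _ ← Δ[x-d₁]⇒ Δ[q-d₁] =
    <⇒≱ (proj₂ (∈-qs⁻ q∈)) (subst (d₁ ≤_) (sym (ℤ.+-injective q≡)) (m≤n+m d₁ w))

  lam-¬Δ : ∀ {q} → q ∈ qs d₁ → ¬ Δ (lam d₁ d₂ pt q)
  lam-¬Δ q∈ Δlam with w , lam≡ , _ , S[w+d₁] ← lam-ApéryGap q∈ = Δ⇒¬S (subst Δ lam≡ Δlam) S[w+d₁]

  lam-Δ[-d₁] : ∀ {q} → q ∈ qs d₁ → Δ (lam d₁ d₂ pt q ℤ.- + d₁)
  lam-Δ[-d₁] q∈ with w , lam≡ , ¬Sw , _ ← lam-ApéryGap q∈ =
    subst Δ (sym (trans (cong (ℤ._- + d₁) lam≡) (cancel (+ w) (+ d₁)))) (¬S⇒Δ ¬Sw)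
    where
    cancel : ∀ a b → a ℤ.+ b ℤ.- b ≡ a
    cancel = ℤ-Solver.solve-∀

  Δ∧¬Δ[x-d₁]⇒low : ∀ {x} → Δ x → ¬ Δ (x ℤ.- + d₁) → ∃ λ q → q ∈ qs d₁ × + q ≡ x
  Δ∧¬Δ[x-d₁]⇒low (k , refl , ¬Sk) ¬Δ[x-d₁] with suc k <? d₁
  ... | yes k<d₁ = suc k , ∈-qs⁺ (s≤s z≤n) k<d₁ , refl
  ... | no k≮d₁ = contradiction (¬Δ[n-d₁]⇒S (≮⇒≥ k≮d₁) ¬Δ[x-d₁]) ¬Sk

  -- q is the residue of -(w + d₁)/d₂ modulo d₁; it is nonzero because w is not a multiple of d₁.
  ApéryGap⇒lam : ∀ {w} → ApéryGap w → ∃ λ q → q ∈ qs d₁ × lam d₁ d₂ pt q ≡ + (w + d₁)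
  ApéryGap⇒lam {w} gap@(¬Sw , _) with coprime⇒residue (<-trans (s≤s z≤n) 1<d₁) d₁⊥d₂ (w + d₁)
  ... | zero , _ , d₁∣w+d₁ with divides k w≡ ← ∣m+n∣m⇒∣n (subst (d₁ ∣_) (+-comm w d₁) d₁∣w+d₁) ∣-refl =
    contradiction (subst S (sym w≡) (S-*d₁ k)) ¬Sw
  ... | suc i , q<d₁ , divides K eqK with lam-ApéryGap (∈-qs⁺ (s≤s z≤n) q<d₁)
  ...   | w' , lam≡ , gap' = suc i , ∈-qs⁺ (s≤s z≤n) q<d₁ , trans lam≡ (cong (λ t → + (t + d₁)) w'≡w)
    where
    q = suc i
    P = pt q ∸ 1
    w'≡w : w' ≡ w
    w'≡w = apéry-unique {A = suc P + K} {B = suc d₂} gap' gap (begin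
      w' + (suc P + K) * d₁                       ≡⟨ regroup₁ w' P K d₁ ⟩
      (w' + d₁ + P * d₁) + K * d₁                 ≡⟨ cong (λ t → w' + d₁ + P * d₁ + t) (sym eqK) ⟩
      (w' + d₁ + P * d₁) + (q * d₂ + (w + d₁))    ≡⟨ regroup₂ (w' + d₁ + P * d₁) (q * d₂) (w + d₁) ⟩
      (w' + d₁ + P * d₁ + q * d₂) + (w + d₁)      ≡⟨ cong (_+ (w + d₁)) (val≡+⇒ d₁ d₂ P q lam≡) ⟩
      d₁ * d₂ + (w + d₁)                          ≡⟨ regroup₃ d₁ d₂ w ⟩
      w + suc d₂ * d₁                             ∎)
      where
      regroup₁ : ∀ w' P K d₁ → w' + (suc P + K) * d₁ ≡ (w' + d₁ + P * d₁) + K * d₁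
      regroup₁ = solve-∀
      regroup₂ : ∀ a b c → a + (b + c) ≡ a + b + c
      regroup₂ = solve-∀
      regroup₃ : ∀ d₁ d₂ w → d₁ * d₂ + (w + d₁) ≡ w + suc d₂ * d₁
      regroup₃ = solve-∀

  lam-injective : ∀ {q q'} → q ∈ qs d₁ → q' ∈ qs d₁ → lam d₁ d₂ pt q' ≡ lam d₁ d₂ pt q → q' ≡ q
  lam-injective {q} {q'} q∈ q'∈ lam≡lam with w , lam≡ , _ ← lam-ApéryGap q∈ =
    coprime-cancel d₁⊥d₂ {pt q' ∸ 1} {pt q ∸ 1} (proj₂ (∈-qs⁻ q'∈)) (proj₂ (∈-qs⁻ q∈))
      (+-cancelˡ-≡ (w + d₁) _ _ (trans (lam≡+⇒ q' (trans lam≡lam lam≡)) (sym (lam≡+⇒ q lam≡))))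
    where
    lam≡+⇒ : ∀ q → lam d₁ d₂ pt q ≡ + (w + d₁) → (w + d₁) + ((pt q ∸ 1) * d₁ + q * d₂) ≡ d₁ * d₂
    lam≡+⇒ q lam≡ = trans (sym (+-assoc (w + d₁) _ _)) (val≡+⇒ d₁ d₂ (pt q ∸ 1) q lam≡)

  ¬Δ⇒#low≡0 : ∀ {x} → ¬ Δ x → #low x ≡ 0
  ¬Δ⇒#low≡0 {x} ¬Δx = length-filter-none (low≟ x) (qs d₁) λ q∈ q≡x → ¬Δx (subst Δ q≡x (low-Δ q∈))

  Δ[x-d₁]⇒#low≡0 : ∀ {x} → Δ (x ℤ.- + d₁) → #low x ≡ 0
  Δ[x-d₁]⇒#low≡0 {x} Δ[x-d₁] = length-filter-none (low≟ x) (qs d₁) λ { q∈ refl → low-¬Δ[-d₁] q∈ Δ[x-d₁] }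

  Δ∧¬Δ[x-d₁]⇒#low≡1 : ∀ {x} → Δ x → ¬ Δ (x ℤ.- + d₁) → #low x ≡ 1
  Δ∧¬Δ[x-d₁]⇒#low≡1 {x} Δx ¬Δ[x-d₁] with q , q∈ , q≡x ← Δ∧¬Δ[x-d₁]⇒low Δx ¬Δ[x-d₁] =
    length-filter-unique (low≟ x) (qs-unique d₁) q∈ q≡x λ _ q'≡x → ℤ.+-injective (trans q'≡x (sym q≡x))

  Δ⇒#lam≡0 : ∀ {x} → Δ x → #lam x ≡ 0
  Δ⇒#lam≡0 {x} Δx = length-filter-none (lam≟ x) (qs d₁) λ { q∈ refl → lam-¬Δ q∈ Δx }

  ¬Δ[x-d₁]⇒#lam≡0 : ∀ {x} → ¬ Δ (x ℤ.- + d₁) → #lam x ≡ 0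
  ¬Δ[x-d₁]⇒#lam≡0 {x} ¬Δ[x-d₁] =
    length-filter-none (lam≟ x) (qs d₁) λ { q∈ refl → ¬Δ[x-d₁] (lam-Δ[-d₁] q∈) }

  ¬Δ∧Δ[x-d₁]⇒#lam≡1 : ∀ {x} → ¬ Δ x → Δ (x ℤ.- + d₁) → #lam x ≡ 1
  ¬Δ∧Δ[x-d₁]⇒#lam≡1 {x} ¬Δx Δ[x-d₁] with w , refl , ¬Sw ← Δ[x-d₁]⇒ {x} Δ[x-d₁]
    with q , q∈ , lam≡x ← ApéryGap⇒lam (¬Sw , ¬Δ⇒S ¬Δx) =
    length-filter-unique (lam≟ (+ (w + d₁))) (qs-unique d₁) q∈ lam≡x λ q'∈ lam'≡x →
      lam-injective q∈ q'∈ (trans lam'≡x (sym lam≡x))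

  coeffRHS≡ : ∀ {x a b} → #low x ≡ a → #lam x ≡ b → + a ℤ.- + b ≡ coeffRHS d₁ d₂ pt x
  coeffRHS≡ #low≡ #lam≡ = sym (cong₂ (λ a b → + a ℤ.- + b) #low≡ #lam≡)

theorem3 : (d₁ d₂ d₃ : ℕ) → 1 < d₁ → d₁ < d₂ → d₂ < d₃ → gcd d₁ d₂ ≡ 1 →
    Minimal d₁ d₂ d₃ →
    (pt : ℕ → ℕ) → (∀ q → 1 ≤ q → q ≤ d₁ ∸ 1 → IsPt d₁ d₂ d₃ q (pt q)) →
    (x : ℤ) → coeffLHS d₁ d₂ d₃ x ≡ coeffRHS d₁ d₂ pt x
theorem3 d₁ d₂ d₃ 1<d₁ d₁<d₂ d₂<d₃ gcd≡1 _ pt pt-spec = coefficient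
  where
  open Coefficients d₁ d₂ d₃ 1<d₁ d₁<d₂ d₂<d₃ (gcd≡1⇒coprime gcd≡1) pt pt-spec
  coefficient : ∀ x → coeffLHS d₁ d₂ d₃ x ≡ coeffRHS d₁ d₂ pt x
  coefficient x with InΔ? d₁ d₂ d₃ x | InΔ? d₁ d₂ d₃ (x ℤ.- + d₁)
  ... | yes Δx | yes Δ[x-d₁] = coeffRHS≡ (Δ[x-d₁]⇒#low≡0 Δ[x-d₁]) (Δ⇒#lam≡0 Δx)
  ... | yes Δx | no ¬Δ[x-d₁] = coeffRHS≡ (Δ∧¬Δ[x-d₁]⇒#low≡1 Δx ¬Δ[x-d₁]) (Δ⇒#lam≡0 Δx)
  ... | no ¬Δx | yes Δ[x-d₁] = coeffRHS≡ (¬Δ⇒#low≡0 ¬Δx) (¬Δ∧Δ[x-d₁]⇒#lam≡1 ¬Δx Δ[x-d₁])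
  ... | no ¬Δx | no ¬Δ[x-d₁] = coeffRHS≡ (¬Δ⇒#low≡0 ¬Δx) (¬Δ[x-d₁]⇒#lam≡0 ¬Δ[x-d₁])
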